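{- Let $n>3$ and let $\Gamma$ be an $n$-uniform finite graph with automorphism group $G=\mathrm{Aut}(\Gamma)$. Assume $\Gamma$ has $r\ge1$ nontrivial orbits and that $m\ge0$ is the number of fixed points of $G$. If the action of $G$ on each nontrivial orbit is $2$-transitive, then $G=S_n^{(r_1)}\oplus\cdots\oplus S_n^{(r_s)}\oplus I_m$ for some $s\ge1$ and positive integers $r_1,\dots,r_s$ with $r_1+\cdots+r_s=r$ (where for $m=0$ the summand $I_m$ is absent).
   Context: Graphs are finite and simple. The orbits of $\Gamma$ are the orbits of $\mathrm{Aut}(\Gamma)$ on vertices; an orbit of size 1 (a fixed point) is trivial. The edge-orbits of $\Gamma$ are the orbits of $\mathrm{Aut}(\Gamma)$ acting on the edge set. For $n>2$, a graph is $n$-uniform if every nontrivial orbit has size $n$ and every edge-orbit has size $n$. Permutation groups are considered up to permutation isomorphism; $S_n$ is the symmetric group in its natural action on $n$ points, $I_m$ the trivial group on $m$ points. The direct sum $G\oplus H$ of permutation groups $(G,Y)$, $(H,Z)$ is $G\times H$ acting on the disjoint union $Y\cup Z$ componentwise. The parallel multiple $S_n^{(k)}$ is $S_n$ acting simultaneously on $k$ disjoint copies of $\{1,\dots,n\}$, each $g$ acting on every copy as on $\{1,\dots,n\}$. -}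

module Defs where

open import Data.Nat using (ℕ; zero; suc; _+_; _≤_; _<_)
open import Data.Fin using (Fin; zero; suc)
open import Data.Fin.Permutation using (Permutation′; _⟨$⟩ʳ_)
open import Data.Bool using (Bool; true; false)
open import Data.Product using (Σ; ∃; ∃-syntax; _×_; _,_; proj₁; proj₂)
open import Data.Sum using (_⊎_; inj₁; inj₂)
open import Function.Bundles using (_↔_; _⇔_; Inverse)
open import Relation.Binary.PropositionalEquality using (_≡_; _≢_)
open import Relation.Nullary using (¬_)

record Graph (N : ℕ) : Set where
  field
    adj    : Fin N → Fin N → Bool
    sym    : ∀ i j → adj i j ≡ adj j i
    irrefl : ∀ i → adj i i ≡ false
open Graph public

IsAut : ∀ {N} → Graph N → Permutation′ N → Set
IsAut Γ σ = ∀ i j → adj Γ (σ ⟨$⟩ʳ i) (σ ⟨$⟩ʳ j) ≡ adj Γ i j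

InOrbit : ∀ {N} → Graph N → Fin N → Fin N → Set
InOrbit Γ x y = Σ (Permutation′ _) λ σ → IsAut Γ σ × (σ ⟨$⟩ʳ x ≡ y)

IsFixed : ∀ {N} → Graph N → Fin N → Set
IsFixed Γ x = ∀ σ → IsAut Γ σ → σ ⟨$⟩ʳ x ≡ x

-- Cardinality of a predicate P on A, counted up to an equivalence _≈_:
-- an enumeration by Fin k, without repetition, of exactly the elements of P.
HasCard : {A : Set} → (A → A → Set) → (A → Set) → ℕ → Set
HasCard {A} _≈_ P k =
  Σ (Fin k → A) λ f →
    (∀ i → P (f i)) ×
    (∀ i j → f i ≈ f j → i ≡ j) ×
    (∀ a → P a → ∃[ i ] (f i ≈ a))

-- Edges: ordered pairs (u , v) with u ~ v, compared as unordered pairs.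
IsEdge : ∀ {N} → Graph N → Fin N × Fin N → Set
IsEdge Γ (u , v) = adj Γ u v ≡ true

_≈ₑ_ : ∀ {N} → Fin N × Fin N → Fin N × Fin N → Set
(a , b) ≈ₑ (c , d) = (a ≡ c × b ≡ d) ⊎ (a ≡ d × b ≡ c)

InEdgeOrbit : ∀ {N} → Graph N → Fin N × Fin N → Fin N × Fin N → Set
InEdgeOrbit Γ (u , v) e' =
  IsEdge Γ e' × Σ (Permutation′ _) λ σ → IsAut Γ σ × ((σ ⟨$⟩ʳ u , σ ⟨$⟩ʳ v) ≈ₑ e')

Uniform : ∀ {N} → ℕ → Graph N → Set
Uniform n Γ =
  (∀ x → ¬ IsFixed Γ x → HasCard _≡_ (InOrbit Γ x) n) ×
  (∀ e → IsEdge Γ e → HasCard _≈ₑ_ (InEdgeOrbit Γ e) n)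

NumNontrivialOrbits : ∀ {N} → Graph N → ℕ → Set
NumNontrivialOrbits {N} Γ r =
  Σ (Fin r → Fin N) λ rep →
    (∀ i → ¬ IsFixed Γ (rep i)) ×
    (∀ i j → InOrbit Γ (rep i) (rep j) → i ≡ j) ×
    (∀ x → ¬ IsFixed Γ x → ∃[ i ] InOrbit Γ (rep i) x)

NumFixedPoints : ∀ {N} → Graph N → ℕ → Set
NumFixedPoints Γ m = HasCard _≡_ (IsFixed Γ) m

TwoTransitiveOnOrbit : ∀ {N} → Graph N → Fin N → Set
TwoTransitiveOnOrbit Γ x =
  ∀ a b c d → InOrbit Γ x a → InOrbit Γ x b → InOrbit Γ x c → InOrbit Γ x d →
  a ≢ b → c ≢ d →
  Σ (Permutation′ _) λ σ → IsAut Γ σ × (σ ⟨$⟩ʳ a ≡ c) × (σ ⟨$⟩ʳ b ≡ d)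

∑ : ∀ {s} → (Fin s → ℕ) → ℕ
∑ {zero}  f = 0
∑ {suc s} f = f zero + ∑ (λ i → f (suc i))

-- Point set of S_n^(r_1) ⊕ ... ⊕ S_n^(r_s) ⊕ I_m:
-- inj₁ (b , c , p) is point p of copy c of block b; inj₂ i is fixed point i.
Points : (n s : ℕ) → (Fin s → ℕ) → ℕ → Set
Points n s rs m = (Σ (Fin s) λ b → Fin (rs b) × Fin n) ⊎ Fin m

-- Action of (π_1,...,π_s) ∈ S_n × ... × S_n: π_b acts on every copy in block b
-- (parallel multiple); fixed points are fixed (I_m).
act : ∀ {n s rs m} → (Fin s → Permutation′ n) → Points n s rs m → Points n s rs m
act πs (inj₁ (b , c , p)) = inj₁ (b , c , πs b ⟨$⟩ʳ p)
act πs (inj₂ i)           = inj₂ i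

-- Aut(Γ) is permutation isomorphic to S_n^(r_1) ⊕ ... ⊕ S_n^(r_s) ⊕ I_m:
-- a bijection φ from the vertices to the points conjugating Aut(Γ) exactly
-- onto the group { act πs }.
PermIsoToSum : ∀ {N} → Graph N → (n s : ℕ) → (rs : Fin s → ℕ) → (m : ℕ) → Set
PermIsoToSum {N} Γ n s rs m =
  Σ (Fin N ↔ Points n s rs m) λ φ →
    ∀ (σ : Permutation′ N) →
      IsAut Γ σ ⇔
      (∃[ πs ] ∀ x → Inverse.to φ (σ ⟨$⟩ʳ x) ≡ act {n} {s} {rs} {m} πs (Inverse.to φ x))

{-# OPTIONS --safe #-}
module Submission where

-- Write x ≼ y when the stabiliser G_x fixes y. In a 2-transitive orbit of size ≥ 3, x ≼ y
-- with y in the orbit of x forces y = x, and since all nontrivial orbits have the same size n,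
-- ≼ is symmetric between moved vertices (G_x ⊆ G_y with equal indices gives G_x = G_y).
-- An orbit of size n ≥ 4 spans no edge: its more than n pairs would all lie in one edge orbit.
-- So an edge uv with u moved leaves the orbit of u, and as its edge orbit has size n too,
-- G_u fixes v: u ≼ v. Grouping orbits into blocks along ≼, every moved vertex is labelled by
-- its orbit and by the point of a base orbit with the same stabiliser. An automorphism acts
-- on these labels by one permutation of Fin n per block; conversely, any such permutations
-- preserve adjacency, which between moved vertices is determined by ≼ and the orbits, and
-- between a fixed and a moved vertex by the orbit alone.

open import Data.Nat using (ℕ; zero; suc; _+_; _≤_; _<_; z≤n; s≤s)
open import Data.Nat.Properties using (≤-trans; m≤n+m; n<1+n; n≤1+n; +-commutativeSemigroup)
open import Data.Fin using (Fin; zero; suc; fromℕ<; punchOut; _↑ˡ_; _↑ʳ_; splitAt; join)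
open import Data.Fin.Properties
  using (punchOut-injective; suc-injective; <⇒notInjective; any?; all?; _≟_; pigeonhole; <⇒≢;
         splitAt-↑ˡ; splitAt-↑ʳ; join-splitAt)
open import Data.Vec using (Vec; []; _∷_; lookup; tabulate)
open import Data.Vec.Properties using (lookup∘tabulate)
open import Data.Bool using (true; false; if_then_else_)
import Data.Bool.Properties as Bool
open import Data.Product using (Σ; ∃-syntax; _×_; _,_; proj₁; proj₂)
open import Data.Sum using (_⊎_; inj₁; inj₂; [_,_]′)
open import Data.Empty using (⊥; ⊥-elim)
open import Relation.Binary.PropositionalEquality
open import Relation.Binary.Structures using (IsDecEquivalence)
import Relation.Binary.Construct.On as On
open import Relation.Nullary using (¬_; Dec; yes; no; does; ¬?)
open import Relation.Nullary.Decidable using (_×-dec_; _→-dec_; map′)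
open import Algebra.Properties.CommutativeSemigroup +-commutativeSemigroup using (interchange)
open import Function using (_∘_)
open import Function.Bundles using (Injection; Inverse; _↔_; _⇔_; mk↔ₛ′; mk⇔)
open import Function.Properties.Inverse using (↔⇒↣)
open import Data.Fin.Permutation using (Permutation′; _⟨$⟩ʳ_; _⟨$⟩ˡ_; _∘ₚ_; flip; inverseˡ; inverseʳ; permutation)
import Data.Fin.Permutation as P
open import Defs hiding (sym)

injective⇒surjective : ∀ {n} (f : Fin n → Fin n) → (∀ i j → f i ≡ f j → i ≡ j) →
                       ∀ y → ∃[ x ] f x ≡ y
injective⇒surjective {zero}  f f-inj ()
injective⇒surjective {suc n} f f-inj y with any? (λ x → f x ≟ y)
... | yes hit = hit
... | no miss = ⊥-elim (<⇒notInjective (n<1+n n) avoid-injective)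
  where
  y≢f : ∀ x → y ≢ f x
  y≢f x y≡fx = miss (x , sym y≡fx)
  avoid : Fin (suc n) → Fin n
  avoid x = punchOut (y≢f x)
  avoid-injective : ∀ {a b} → avoid a ≡ avoid b → a ≡ b
  avoid-injective {a} {b} eq = f-inj a b (punchOut-injective (y≢f a) (y≢f b) eq)

surjective⇒injective : ∀ {n} (f : Fin n → Fin n) → (∀ y → ∃[ x ] f x ≡ y) →
                       ∀ i j → f i ≡ f j → i ≡ j
surjective⇒injective f f-surj i j fi≡fj = begin
  i        ≡⟨ sym (g∘f≗id i) ⟩
  g (f i)  ≡⟨ cong g fi≡fj ⟩
  g (f j)  ≡⟨ g∘f≗id j ⟩
  j        ∎
  where
  open ≡-Reasoning
  g : _ → _
  g y = proj₁ (f-surj y)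
  f∘g≗id : ∀ y → f (g y) ≡ y
  f∘g≗id y = proj₂ (f-surj y)
  g-surj : ∀ i → ∃[ y ] g y ≡ i
  g-surj = injective⇒surjective g λ a b ga≡gb →
    trans (sym (f∘g≗id a)) (trans (cong f ga≡gb) (f∘g≗id b))
  g∘f≗id : ∀ i → g (f i) ≡ i
  g∘f≗id i with y , gy≡i ← g-surj i = begin
    g (f i)      ≡⟨ cong (g ∘ f) (sym gy≡i) ⟩
    g (f (g y))  ≡⟨ cong g (f∘g≗id y) ⟩
    g y          ≡⟨ gy≡i ⟩
    i            ∎

permutationOfInjection : ∀ {n} (f : Fin n → Fin n) → (∀ i j → f i ≡ f j → i ≡ j) → Permutation′ n
permutationOfInjection f f-inj =
  permutation f (proj₁ ∘ f-onto) (proj₂ ∘ f-onto) (λ x → f-inj _ _ (proj₂ (f-onto (f x))))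
  where f-onto = injective⇒surjective f f-inj

all-vectors? : ∀ {N k} (Q : Vec (Fin N) k → Set) → (∀ v → Dec (Q v)) → Dec (∀ v → Q v)
all-vectors? {k = zero} Q Q? with Q? []
... | yes q = yes λ { [] → q }
... | no ¬q = no λ all → ¬q (all [])
all-vectors? {k = suc k} Q Q? with all? (λ a → all-vectors? (λ w → Q (a ∷ w)) (λ w → Q? (a ∷ w)))
... | yes q = yes λ { (a ∷ w) → q a w }
... | no ¬q = no λ all → ¬q (λ a w → all (a ∷ w))

avoid-two : ∀ {N n} → 2 < n → (e : Fin n → Fin N) → (∀ i j → e i ≡ e j → i ≡ j) →
            ∀ x y → ∃[ k ] (e k ≢ x × e k ≢ y)
avoid-two {n = n} 2<n e e-inj x y with any? (λ k → ¬? (e k ≟ x) ×-dec ¬? (e k ≟ y))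
... | yes found = found
... | no none =
  let (i , j , i<j , same) = pigeonhole 2<n side
  in ⊥-elim (<⇒≢ i<j (e-inj i j (same-side⇒equal i j same)))
  where
  hits : ∀ k → e k ≡ x ⊎ e k ≡ y
  hits k with e k ≟ x | e k ≟ y
  ... | yes ≡x | _     = inj₁ ≡x
  ... | no _   | yes ≡y = inj₂ ≡y
  ... | no ≢x  | no ≢y  = ⊥-elim (none (k , ≢x , ≢y))
  side : Fin n → Fin 2
  side k = [ (λ _ → zero) , (λ _ → suc zero) ]′ (hits k)
  same-side⇒equal : ∀ i j → side i ≡ side j → e i ≡ e j
  same-side⇒equal i j eq with hits i | hits j
  ... | inj₁ ≡x | inj₁ ≡x′ = trans ≡x (sym ≡x′)
  ... | inj₂ ≡y | inj₂ ≡y′ = trans ≡y (sym ≡y′)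
  ... | inj₁ _  | inj₂ _   with () ← eq
  ... | inj₂ _  | inj₁ _   with () ← eq

≈ₑ-sym : ∀ {N} {p q : Fin N × Fin N} → p ≈ₑ q → q ≈ₑ p
≈ₑ-sym (inj₁ (a≡c , b≡d)) = inj₁ (sym a≡c , sym b≡d)
≈ₑ-sym (inj₂ (a≡d , b≡c)) = inj₂ (sym b≡c , sym a≡d)

≈ₑ-trans : ∀ {N} {p q t : Fin N × Fin N} → p ≈ₑ q → q ≈ₑ t → p ≈ₑ t
≈ₑ-trans (inj₁ (x , y)) (inj₁ (x′ , y′)) = inj₁ (trans x x′ , trans y y′)
≈ₑ-trans (inj₁ (x , y)) (inj₂ (x′ , y′)) = inj₂ (trans x x′ , trans y y′)
≈ₑ-trans (inj₂ (x , y)) (inj₁ (x′ , y′)) = inj₂ (trans x y′ , trans y x′)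
≈ₑ-trans (inj₂ (x , y)) (inj₂ (x′ , y′)) = inj₁ (trans x y′ , trans y x′)

≈ₑ-viaIndex : ∀ {k N} (ε : Fin k → Fin N × Fin N) {i j p q} → ε i ≈ₑ p → ε j ≈ₑ q → i ≡ j → p ≈ₑ q
≈ₑ-viaIndex ε εi≈p εj≈q refl = ≈ₑ-trans (≈ₑ-sym εi≈p) εj≈q

≈ₑ-reflectsInjective : ∀ {n N} (e : Fin n → Fin N) → (∀ i j → e i ≡ e j → i ≡ j) →
                       ∀ {a b c d} → (e a , e b) ≈ₑ (e c , e d) → (a , b) ≈ₑ (c , d)
≈ₑ-reflectsInjective e e-inj (inj₁ (x , y)) = inj₁ (e-inj _ _ x , e-inj _ _ y)
≈ₑ-reflectsInjective e e-inj (inj₂ (x , y)) = inj₂ (e-inj _ _ x , e-inj _ _ y)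

module _ {k : ℕ} where

  manyPairs : Fin (5 + k) → Fin (4 + k) × Fin (4 + k)
  manyPairs zero                = suc zero , suc (suc zero)
  manyPairs (suc zero)          = suc zero , suc (suc (suc zero))
  manyPairs (suc (suc j))       = zero , suc j

  manyPairs-distinct : ∀ i → proj₁ (manyPairs i) ≢ proj₂ (manyPairs i)
  manyPairs-distinct zero          ()
  manyPairs-distinct (suc zero)    ()
  manyPairs-distinct (suc (suc j)) ()

  manyPairs-injective : ∀ i j → manyPairs i ≈ₑ manyPairs j → i ≡ j
  manyPairs-injective zero          zero          _                 = refl
  manyPairs-injective (suc zero)    (suc zero)    _                 = refl
  manyPairs-injective (suc (suc i)) (suc (suc j)) (inj₁ (_ , eq))   = cong (λ j → suc (suc j)) (suc-injective eq)
  manyPairs-injective (suc (suc i)) (suc (suc j)) (inj₂ (() , _))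
  manyPairs-injective zero          (suc zero)    (inj₁ (_ , ()))
  manyPairs-injective zero          (suc zero)    (inj₂ (() , _))
  manyPairs-injective zero          (suc (suc j)) (inj₁ (() , _))
  manyPairs-injective zero          (suc (suc j)) (inj₂ (_ , ()))
  manyPairs-injective (suc zero)    zero          (inj₁ (_ , ()))
  manyPairs-injective (suc zero)    zero          (inj₂ (() , _))
  manyPairs-injective (suc zero)    (suc (suc j)) (inj₁ (() , _))
  manyPairs-injective (suc zero)    (suc (suc j)) (inj₂ (_ , ()))
  manyPairs-injective (suc (suc i)) zero          (inj₁ (() , _))
  manyPairs-injective (suc (suc i)) zero          (inj₂ (() , _))
  manyPairs-injective (suc (suc i)) (suc zero)    (inj₁ (() , _))
  manyPairs-injective (suc (suc i)) (suc zero)    (inj₂ (() , _))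

unorderedPairs-notIndexable : ∀ {n} → 3 < n → (idx : (a b : Fin n) → a ≢ b → Fin n) →
  ¬ (∀ a b c d a≢b c≢d → idx a b a≢b ≡ idx c d c≢d → (a , b) ≈ₑ (c , d))
unorderedPairs-notIndexable {suc (suc (suc zero))} (s≤s (s≤s (s≤s ())))
unorderedPairs-notIndexable {suc (suc (suc (suc k)))} _ idx idx-inj =
  let (i , j , i<j , same) = pigeonhole (n<1+n _) pairIndex
  in <⇒≢ i<j (manyPairs-injective i j (idx-inj _ _ _ _ _ _ same))
  where
  pairIndex : Fin (5 + k) → Fin (4 + k)
  pairIndex i = idx (proj₁ (manyPairs i)) (proj₂ (manyPairs i)) (manyPairs-distinct i)

∑-+ : ∀ {s} (f g : Fin s → ℕ) → ∑ (λ b → f b + g b) ≡ ∑ f + ∑ g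
∑-+ {zero}  f g = refl
∑-+ {suc s} f g = begin
  f zero + g zero + ∑ (λ b → f (suc b) + g (suc b))    ≡⟨ cong (f zero + g zero +_) (∑-+ (f ∘ suc) (g ∘ suc)) ⟩
  f zero + g zero + (∑ (f ∘ suc) + ∑ (g ∘ suc))        ≡⟨ interchange (f zero) (g zero) _ _ ⟩
  f zero + ∑ (f ∘ suc) + (g zero + ∑ (g ∘ suc))        ∎
  where open ≡-Reasoning

∑-zero : ∀ {s} → ∑ {s} (λ _ → 0) ≡ 0
∑-zero {zero}  = refl
∑-zero {suc s} = ∑-zero {s}

indicator : ∀ {s} → Fin s → Fin s → ℕ
indicator b₀ b = if does (b ≟ b₀) then 1 else 0

∑-indicator : ∀ {s} (b₀ : Fin s) → ∑ (indicator b₀) ≡ 1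
∑-indicator {suc s} zero = cong suc (∑-zero {s})
∑-indicator {suc s} (suc b₀) = ∑-indicator b₀

indicator-self : ∀ {s} (b₀ : Fin s) → Fin (indicator b₀ b₀)
indicator-self b₀ with b₀ ≟ b₀
... | yes _ = zero
... | no b₀≢b₀ = ⊥-elim (b₀≢b₀ refl)

indicator-support : ∀ {s} (b₀ b : Fin s) → Fin (indicator b₀ b) → b ≡ b₀
indicator-support b₀ b i with b ≟ b₀
... | yes b≡b₀ = b≡b₀

indicator-unique : ∀ {s} (b₀ b : Fin s) (i j : Fin (indicator b₀ b)) → i ≡ j
indicator-unique b₀ b i j with b ≟ b₀
indicator-unique b₀ b zero zero | yes _ = refl

record Partition (r : ℕ) (R : Fin r → Fin r → Set) : Set where
  field
    s            : ℕ
    rs           : Fin s → ℕ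
    rs-positive  : ∀ b → 1 ≤ rs b
    ∑rs≡r        : ∑ rs ≡ r
    block        : Fin r → Fin s
    copy         : (i : Fin r) → Fin (rs (block i))
    member       : (b : Fin s) → Fin (rs b) → Fin r
    member-copy  : ∀ i → member (block i) (copy i) ≡ i
    copy-member  : ∀ b c → _≡_ {A = Σ (Fin s) (Fin ∘ rs)} (block (member b c) , copy (member b c)) (b , c)
    related⇒sameBlock : ∀ i j → R i j → block i ≡ block j
    sameBlock⇒related : ∀ i j → block i ≡ block j → R i j

module _ {r} {R : Fin (suc r) → Fin (suc r) → Set} (R-equiv : IsDecEquivalence R)
         (P : Partition r (λ i j → R (suc i) (suc j))) where
  open IsDecEquivalence R-equiv using () renaming (refl to R-refl; sym to R-sym; trans to R-trans)
  open Partition P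

  addSingletonBlock : (∀ j → ¬ R zero (suc j)) → Partition (suc r) R
  addSingletonBlock isolated = record
    { s = suc s ; rs = rs′ ; rs-positive = rs′-positive ; ∑rs≡r = cong suc ∑rs≡r
    ; block = block′ ; copy = copy′ ; member = member′
    ; member-copy = member-copy′ ; copy-member = copy-member′
    ; related⇒sameBlock = related⇒sameBlock′ ; sameBlock⇒related = sameBlock⇒related′ }
    where
    rs′ : Fin (suc s) → ℕ
    rs′ zero    = 1
    rs′ (suc b) = rs b
    rs′-positive : ∀ b → 1 ≤ rs′ b
    rs′-positive zero    = s≤s z≤n
    rs′-positive (suc b) = rs-positive b
    block′ : Fin (suc r) → Fin (suc s)
    block′ zero    = zero
    block′ (suc i) = suc (block i)
    copy′ : (i : Fin (suc r)) → Fin (rs′ (block′ i))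
    copy′ zero    = zero
    copy′ (suc i) = copy i
    member′ : (b : Fin (suc s)) → Fin (rs′ b) → Fin (suc r)
    member′ zero    _ = zero
    member′ (suc b) c = suc (member b c)
    member-copy′ : ∀ i → member′ (block′ i) (copy′ i) ≡ i
    member-copy′ zero    = refl
    member-copy′ (suc i) = cong suc (member-copy i)
    copy-member′ : ∀ b c → _≡_ {A = Σ (Fin (suc s)) (Fin ∘ rs′)} (block′ (member′ b c) , copy′ (member′ b c)) (b , c)
    copy-member′ zero    zero = refl
    copy-member′ (suc b) c    = cong (λ { (b′ , c′) → suc b′ , c′ }) (copy-member b c)
    related⇒sameBlock′ : ∀ i j → R i j → block′ i ≡ block′ j
    related⇒sameBlock′ zero    zero    _   = refl
    related⇒sameBlock′ zero    (suc j) 0~j = ⊥-elim (isolated j 0~j)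
    related⇒sameBlock′ (suc i) zero    i~0 = ⊥-elim (isolated i (R-sym i~0))
    related⇒sameBlock′ (suc i) (suc j) i~j = cong suc (related⇒sameBlock i j i~j)
    sameBlock⇒related′ : ∀ i j → block′ i ≡ block′ j → R i j
    sameBlock⇒related′ zero    zero    _  = R-refl
    sameBlock⇒related′ (suc i) (suc j) eq = sameBlock⇒related i j (suc-injective eq)

  -- zero joins the block b₀ of j₀ as its first copy; the old copies of b₀ are shifted by one.
  joinBlockOf : ∀ j₀ → R zero (suc j₀) → Partition (suc r) R
  joinBlockOf j₀ 0~j₀ = record
    { s = s ; rs = rs′ ; rs-positive = rs′-positive ; ∑rs≡r = ∑rs′≡1+r
    ; block = block′ ; copy = copy′ ; member = member′
    ; member-copy = member-copy′ ; copy-member = copy-member′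
    ; related⇒sameBlock = related⇒sameBlock′ ; sameBlock⇒related = sameBlock⇒related′ }
    where
    b₀ = block j₀
    δ = indicator b₀
    rs′ : Fin s → ℕ
    rs′ b = δ b + rs b
    rs′-positive : ∀ b → 1 ≤ rs′ b
    rs′-positive b = ≤-trans (rs-positive b) (m≤n+m (rs b) (δ b))
    ∑rs′≡1+r : ∑ rs′ ≡ suc r
    ∑rs′≡1+r = trans (∑-+ δ rs) (cong₂ _+_ (∑-indicator b₀) ∑rs≡r)
    block′ : Fin (suc r) → Fin s
    block′ zero    = b₀
    block′ (suc i) = block i
    copy′ : (i : Fin (suc r)) → Fin (rs′ (block′ i))
    copy′ zero    = indicator-self b₀ ↑ˡ rs b₀
    copy′ (suc i) = δ (block i) ↑ʳ copy i
    memberOfSplit : (b : Fin s) → Fin (δ b) ⊎ Fin (rs b) → Fin (suc r)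
    memberOfSplit b (inj₁ _) = zero
    memberOfSplit b (inj₂ c) = suc (member b c)
    member′ : (b : Fin s) → Fin (rs′ b) → Fin (suc r)
    member′ b c = memberOfSplit b (splitAt (δ b) c)
    member-copy′ : ∀ i → member′ (block′ i) (copy′ i) ≡ i
    member-copy′ zero    rewrite splitAt-↑ˡ (δ b₀) (indicator-self b₀) (rs b₀) = refl
    member-copy′ (suc i) rewrite splitAt-↑ʳ (δ (block i)) (rs (block i)) (copy i) = cong suc (member-copy i)
    copy-member′ : ∀ b c → _≡_ {A = Σ (Fin s) (Fin ∘ rs′)} (block′ (member′ b c) , copy′ (member′ b c)) (b , c)
    copy-member′ b c with splitAt (δ b) c in split
    ... | inj₁ x = newCopy b (indicator-support b₀ b x) c x split
      where
      newCopy : ∀ b → b ≡ b₀ → (c : Fin (rs′ b)) (x : Fin (δ b)) → splitAt (δ b) c ≡ inj₁ x →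
                _≡_ {A = Σ (Fin s) (Fin ∘ rs′)} (b₀ , indicator-self b₀ ↑ˡ rs b₀) (b , c)
      newCopy b refl c x split = cong (b₀ ,_) (begin
        indicator-self b₀ ↑ˡ rs b₀           ≡⟨ cong (_↑ˡ rs b₀) (indicator-unique b₀ b₀ _ x) ⟩
        join (δ b₀) (rs b₀) (inj₁ x)         ≡⟨ cong (join (δ b₀) (rs b₀)) (sym split) ⟩
        join (δ b₀) (rs b₀) (splitAt _ c)    ≡⟨ join-splitAt (δ b₀) (rs b₀) c ⟩
        c                                    ∎)
        where open ≡-Reasoning
    ... | inj₂ y = trans (cong (λ { (b′ , c′) → b′ , δ b′ ↑ʳ c′ }) (copy-member b y))
                         (cong (b ,_) (trans (cong (join (δ b) (rs b)) (sym split)) (join-splitAt (δ b) (rs b) c)))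
    related⇒sameBlock′ : ∀ i j → R i j → block′ i ≡ block′ j
    related⇒sameBlock′ zero    zero    _   = refl
    related⇒sameBlock′ zero    (suc j) 0~j = related⇒sameBlock j₀ j (R-trans (R-sym 0~j₀) 0~j)
    related⇒sameBlock′ (suc i) zero    i~0 = related⇒sameBlock i j₀ (R-trans i~0 0~j₀)
    related⇒sameBlock′ (suc i) (suc j) i~j = related⇒sameBlock i j i~j
    sameBlock⇒related′ : ∀ i j → block′ i ≡ block′ j → R i j
    sameBlock⇒related′ zero    zero    _  = R-refl
    sameBlock⇒related′ zero    (suc j) eq = R-trans 0~j₀ (sameBlock⇒related j₀ j eq)
    sameBlock⇒related′ (suc i) zero    eq = R-trans (sameBlock⇒related i j₀ eq) (R-sym 0~j₀)
    sameBlock⇒related′ (suc i) (suc j) eq = sameBlock⇒related i j eq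

partition : ∀ r {R : Fin r → Fin r → Set} → IsDecEquivalence R → Partition r R
partition zero    R-equiv = record
  { s = 0 ; rs = λ () ; rs-positive = λ () ; ∑rs≡r = refl ; block = λ () ; copy = λ () ; member = λ ()
  ; member-copy = λ () ; copy-member = λ () ; related⇒sameBlock = λ () ; sameBlock⇒related = λ () }
partition (suc r) {R} R-equiv = extend (any? (λ j → IsDecEquivalence._≟_ R-equiv zero (suc j)))
  where
  restricted = partition r (On.isDecEquivalence suc R-equiv)
  extend : Dec (∃[ j ] R zero (suc j)) → Partition (suc r) R
  extend (yes (j₀ , 0~j₀)) = joinBlockOf R-equiv restricted j₀ 0~j₀
  extend (no isolated)     = addSingletonBlock R-equiv restricted (λ j 0~j → isolated (j , 0~j))

module Automorphisms {N : ℕ} (Γ : Graph N) where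

  Aut-id : IsAut Γ P.id
  Aut-id i j = refl

  Aut-∘ : ∀ σ τ → IsAut Γ σ → IsAut Γ τ → IsAut Γ (σ ∘ₚ τ)
  Aut-∘ σ τ σ-aut τ-aut i j = trans (τ-aut (σ ⟨$⟩ʳ i) (σ ⟨$⟩ʳ j)) (σ-aut i j)

  Aut-flip : ∀ σ → IsAut Γ σ → IsAut Γ (flip σ)
  Aut-flip σ σ-aut i j =
    trans (sym (σ-aut (σ ⟨$⟩ˡ i) (σ ⟨$⟩ˡ j))) (cong₂ (adj Γ) (inverseʳ σ) (inverseʳ σ))

  orbit-refl : ∀ x → InOrbit Γ x x
  orbit-refl x = P.id , Aut-id , refl

  orbit-image : ∀ σ → IsAut Γ σ → ∀ x → InOrbit Γ x (σ ⟨$⟩ʳ x)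
  orbit-image σ σ-aut x = σ , σ-aut , refl

  orbit-sym : ∀ {x y} → InOrbit Γ x y → InOrbit Γ y x
  orbit-sym (σ , σ-aut , σx≡y) =
    flip σ , Aut-flip σ σ-aut , trans (cong (σ ⟨$⟩ˡ_) (sym σx≡y)) (inverseˡ σ)

  orbit-trans : ∀ {x y z} → InOrbit Γ x y → InOrbit Γ y z → InOrbit Γ x z
  orbit-trans (σ , σ-aut , σx≡y) (τ , τ-aut , τy≡z) =
    σ ∘ₚ τ , Aut-∘ σ τ σ-aut τ-aut , trans (cong (τ ⟨$⟩ʳ_) σx≡y) τy≡z

  fixed-orbit : ∀ {x y} → IsFixed Γ x → InOrbit Γ x y → y ≡ x
  fixed-orbit x-fixed (σ , σ-aut , σx≡y) = trans (sym σx≡y) (x-fixed σ σ-aut)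

  nonfixed-orbit : ∀ {x y} → ¬ IsFixed Γ x → InOrbit Γ x y → ¬ IsFixed Γ y
  nonfixed-orbit x-moved x~y y-fixed =
    x-moved (subst (IsFixed Γ) (sym (fixed-orbit y-fixed (orbit-sym x~y))) y-fixed)

  infix 4 _≼_
  _≼_ : Fin N → Fin N → Set
  x ≼ y = ∀ σ → IsAut Γ σ → σ ⟨$⟩ʳ x ≡ x → σ ⟨$⟩ʳ y ≡ y

  ≼-refl : ∀ x → x ≼ x
  ≼-refl x σ σ-aut σx≡x = σx≡x

  ≼-trans : ∀ {x y z} → x ≼ y → y ≼ z → x ≼ z
  ≼-trans x≼y y≼z σ σ-aut σx≡x = y≼z σ σ-aut (x≼y σ σ-aut σx≡x)

  ≼-agree : ∀ ρ τ {x y} → IsAut Γ ρ → IsAut Γ τ → x ≼ y →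
            ρ ⟨$⟩ʳ x ≡ τ ⟨$⟩ʳ x → ρ ⟨$⟩ʳ y ≡ τ ⟨$⟩ʳ y
  ≼-agree ρ τ ρ-aut τ-aut x≼y ρx≡τx =
    trans (sym (inverseʳ τ)) (cong (τ ⟨$⟩ʳ_) (x≼y (ρ ∘ₚ flip τ) (Aut-∘ ρ (flip τ) ρ-aut (Aut-flip τ τ-aut))
      (trans (cong (τ ⟨$⟩ˡ_) ρx≡τx) (inverseˡ τ))))

  ≼-image : ∀ τ {x y} → IsAut Γ τ → x ≼ y → τ ⟨$⟩ʳ x ≼ τ ⟨$⟩ʳ y
  ≼-image τ τ-aut x≼y σ σ-aut στx≡τx =
    ≼-agree (τ ∘ₚ σ) τ (Aut-∘ τ σ τ-aut σ-aut) τ-aut x≼y στx≡τx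

  -- Aut Γ is finite: ≼ is decided by running over all tables v of maps Fin N → Fin N.
  private
    PreservesAdj : (Fin N → Fin N) → Set
    PreservesAdj f = ∀ i j → adj Γ (f i) (f j) ≡ adj Γ i j

    IsInjective : (Fin N → Fin N) → Set
    IsInjective f = ∀ i j → f i ≡ f j → i ≡ j

    TableFixes : Fin N → Fin N → Vec (Fin N) N → Set
    TableFixes x y v = IsInjective (lookup v) → PreservesAdj (lookup v) → lookup v x ≡ x → lookup v y ≡ y

    tableFixes? : ∀ x y v → Dec (TableFixes x y v)
    tableFixes? x y v =
      injective? →-dec (preserves? →-dec ((lookup v x ≟ x) →-dec (lookup v y ≟ y)))
      where
      injective? = all? λ i → all? λ j → (lookup v i ≟ lookup v j) →-dec (i ≟ j)
      preserves? = all? λ i → all? λ j → adj Γ (lookup v i) (lookup v j) Bool.≟ adj Γ i j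

    ≼⇒tableFixes : ∀ {x y} → x ≼ y → ∀ v → TableFixes x y v
    ≼⇒tableFixes x≼y v v-inj v-adj = x≼y (permutationOfInjection (lookup v) v-inj) v-adj

    tableFixes⇒≼ : ∀ {x y} → (∀ v → TableFixes x y v) → x ≼ y
    tableFixes⇒≼ {x} {y} all σ σ-aut σx≡x =
      trans (sym (table y)) (all v v-inj v-adj (trans (table x) σx≡x))
      where
      v = tabulate (σ ⟨$⟩ʳ_)
      table : ∀ i → lookup v i ≡ σ ⟨$⟩ʳ i
      table = lookup∘tabulate (σ ⟨$⟩ʳ_)
      v-inj : IsInjective (lookup v)
      v-inj i j eq = Injection.injective (↔⇒↣ σ) (trans (sym (table i)) (trans eq (table j)))
      v-adj : PreservesAdj (lookup v)
      v-adj i j = trans (cong₂ (adj Γ) (table i) (table j)) (σ-aut i j)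

  _≼?_ : ∀ x y → Dec (x ≼ y)
  x ≼? y = map′ tableFixes⇒≼ ≼⇒tableFixes (all-vectors? (TableFixes x y) (tableFixes? x y))

  twoTransitiveOrbit-≼⇒≡ : ∀ {k x y} → 2 < k → HasCard _≡_ (InOrbit Γ x) k → TwoTransitiveOnOrbit Γ x →
              InOrbit Γ x y → x ≼ y → x ≡ y
  twoTransitiveOrbit-≼⇒≡ {x = x} {y} 2<k (e , e-orbit , e-inj , _) two-trans x~y x≼y with x ≟ y
  ... | yes x≡y = x≡y
  ... | no x≢y =
    ⊥-elim (fixing-x-moving-y (two-trans x y x w (orbit-refl x) x~y (orbit-refl x) (e-orbit k) x≢y (≢-sym w≢x)))
    where
    avoiding : ∃[ k ] (e k ≢ x × e k ≢ y)
    avoiding = avoid-two 2<k e e-inj x y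
    k = proj₁ avoiding
    w = e k
    w≢x = proj₁ (proj₂ avoiding)
    w≢y = proj₂ (proj₂ avoiding)
    fixing-x-moving-y : (Σ (Permutation′ N) λ σ → IsAut Γ σ × σ ⟨$⟩ʳ x ≡ x × σ ⟨$⟩ʳ y ≡ w) → ⊥
    fixing-x-moving-y (σ , σ-aut , σx≡x , σy≡w) = w≢y (trans (sym σy≡w) (x≼y σ σ-aut σx≡x))

  -- G_x ⊆ G_y with [G : G_x] = [G : G_y] forces G_x = G_y; concretely, g x ↦ g y is a
  -- well-defined surjection between the two orbits, hence injective.
  equalOrbitSizes-≼-sym : ∀ {k x y} → HasCard _≡_ (InOrbit Γ x) k → HasCard _≡_ (InOrbit Γ y) k → x ≼ y → y ≼ x
  equalOrbitSizes-≼-sym {k} {x} {y} (ex , ex-orbit , ex-inj , ex-onto) (ey , ey-orbit , ey-inj , ey-onto)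
                        x≼y σ σ-aut σy≡y =
    begin
      σ ⟨$⟩ʳ x  ≡⟨ sym (proj₂ at-σx) ⟩
      ex i₁     ≡⟨ cong ex (H-inj i₁ i₀ (ey-inj _ _ ey-Hi₁≡ey-Hi₀)) ⟩
      ex i₀     ≡⟨ proj₂ at-x ⟩
      x         ∎
    where
    open ≡-Reasoning
    τ : Fin k → Permutation′ N
    τ i = proj₁ (ex-orbit i)
    H : Fin k → Fin k
    H i = proj₁ (ey-onto _ (orbit-image (τ i) (proj₁ (proj₂ (ex-orbit i))) y))
    H-spec : ∀ ρ → IsAut Γ ρ → ∀ i → ex i ≡ ρ ⟨$⟩ʳ x → ey (H i) ≡ ρ ⟨$⟩ʳ y
    H-spec ρ ρ-aut i exi≡ρx = trans (proj₂ (ey-onto _ (orbit-image (τ i) τ-aut y)))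
                                     (≼-agree (τ i) ρ τ-aut ρ-aut x≼y (trans τx≡exi exi≡ρx))
      where
      τ-aut = proj₁ (proj₂ (ex-orbit i))
      τx≡exi = proj₂ (proj₂ (ex-orbit i))
    H-onto : ∀ l → ∃[ i ] H i ≡ l
    H-onto l =
      let (ρ , ρ-aut , ρy≡eyl) = ey-orbit l
          (i , exi≡ρx) = ex-onto _ (orbit-image ρ ρ-aut x)
      in i , ey-inj _ _ (trans (H-spec ρ ρ-aut i exi≡ρx) ρy≡eyl)
    H-inj = surjective⇒injective H H-onto
    at-x = ex-onto x (orbit-refl x)
    at-σx = ex-onto (σ ⟨$⟩ʳ x) (orbit-image σ σ-aut x)
    i₀ = proj₁ at-x
    i₁ = proj₁ at-σx
    ey-Hi₁≡ey-Hi₀ : ey (H i₁) ≡ ey (H i₀)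
    ey-Hi₁≡ey-Hi₀ = begin
      ey (H i₁)  ≡⟨ H-spec σ σ-aut i₁ (proj₂ at-σx) ⟩
      σ ⟨$⟩ʳ y   ≡⟨ σy≡y ⟩
      y          ≡⟨ sym (H-spec P.id Aut-id i₀ (proj₂ at-x)) ⟩
      ey (H i₀)  ∎

  edge⇒≢ : ∀ {u v} → adj Γ u v ≡ true → u ≢ v
  edge⇒≢ {u} uv refl with () ← trans (sym uv) (irrefl Γ u)

  edge-image : ∀ {u v} → adj Γ u v ≡ true → ∀ ρ → IsAut Γ ρ →
               InEdgeOrbit Γ (u , v) (ρ ⟨$⟩ʳ u , ρ ⟨$⟩ʳ v)
  edge-image uv ρ ρ-aut = trans (ρ-aut _ _) uv , ρ , ρ-aut , inj₁ (refl , refl)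

  no-edge-in-orbit : ∀ {k u v} → 3 < k → HasCard _≡_ (InOrbit Γ u) k → TwoTransitiveOnOrbit Γ u →
                     HasCard _≈ₑ_ (InEdgeOrbit Γ (u , v)) k → adj Γ u v ≡ true → ¬ InOrbit Γ u v
  no-edge-in-orbit {u = u} {v} 3<k (e , e-orbit , e-inj , _) two-trans (ε , _ , _ , ε-onto) uv u~v =
    unorderedPairs-notIndexable 3<k index index-injective
    where
    pair-edge : ∀ a b → a ≢ b → InEdgeOrbit Γ (u , v) (e a , e b)
    pair-edge a b a≢b =
      let (σ , σ-aut , σu≡ea , σv≡eb) = two-trans u v (e a) (e b) (orbit-refl u) u~v (e-orbit a) (e-orbit b)
                                                  (edge⇒≢ uv) (a≢b ∘ e-inj a b)
      in subst₂ (λ z w → InEdgeOrbit Γ (u , v) (z , w)) σu≡ea σv≡eb (edge-image uv σ σ-aut)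
    index : (a b : Fin _) → a ≢ b → Fin _
    index a b a≢b = proj₁ (ε-onto _ (pair-edge a b a≢b))
    index-injective : ∀ a b c d a≢b c≢d → index a b a≢b ≡ index c d c≢d → (a , b) ≈ₑ (c , d)
    index-injective a b c d a≢b c≢d same = ≈ₑ-reflectsInjective e e-inj
      (≈ₑ-viaIndex ε (proj₂ (ε-onto _ (pair-edge a b a≢b))) (proj₂ (ε-onto _ (pair-edge c d c≢d))) same)

  -- Equal orbit sizes make g u ↦ g(uv) a bijection from the orbit of u onto the edge orbit,
  -- so the stabiliser of u stabilises uv; it cannot swap u and v as they lie in different orbits.
  edge⇒≼ : ∀ {k u v} → HasCard _≡_ (InOrbit Γ u) k → HasCard _≈ₑ_ (InEdgeOrbit Γ (u , v)) k →
           adj Γ u v ≡ true → ¬ InOrbit Γ u v → u ≼ v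
  edge⇒≼ {k} {u} {v} (e , e-orbit , e-inj , _) (ε , _ , _ , ε-onto) uv u≁v σ σ-aut σu≡u =
    begin
      σ ⟨$⟩ʳ v      ≡⟨ proj₂ (proj₂ (lift σ σ-aut)) ⟩
      τ i ⟨$⟩ʳ v    ≡⟨ cong (λ j → τ j ⟨$⟩ʳ v) i≡i′ ⟩
      τ i′ ⟨$⟩ʳ v   ≡⟨ sym (proj₂ (proj₂ (lift P.id Aut-id))) ⟩
      v             ∎
    where
    open ≡-Reasoning
    τ : Fin k → Permutation′ N
    τ i = proj₁ (e-orbit i)
    τ-aut : ∀ i → IsAut Γ (τ i)
    τ-aut i = proj₁ (proj₂ (e-orbit i))
    τu≡e : ∀ i → τ i ⟨$⟩ʳ u ≡ e i
    τu≡e i = proj₂ (proj₂ (e-orbit i))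
    straight : ∀ ρ ρ′ → IsAut Γ ρ → IsAut Γ ρ′ → (ρ ⟨$⟩ʳ u , ρ ⟨$⟩ʳ v) ≈ₑ (ρ′ ⟨$⟩ʳ u , ρ′ ⟨$⟩ʳ v) →
               ρ ⟨$⟩ʳ u ≡ ρ′ ⟨$⟩ʳ u × ρ ⟨$⟩ʳ v ≡ ρ′ ⟨$⟩ʳ v
    straight ρ ρ′ _     _      (inj₁ same)          = same
    straight ρ ρ′ ρ-aut ρ′-aut (inj₂ (ρu≡ρ′v , _)) =
      ⊥-elim (u≁v (orbit-trans (ρ , ρ-aut , ρu≡ρ′v) (orbit-sym (orbit-image ρ′ ρ′-aut v))))
    edgeIndex : ∀ ρ → IsAut Γ ρ → ∃[ l ] ε l ≈ₑ (ρ ⟨$⟩ʳ u , ρ ⟨$⟩ʳ v)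
    edgeIndex ρ ρ-aut = ε-onto _ (edge-image uv ρ ρ-aut)
    H : Fin k → Fin k
    H i = proj₁ (edgeIndex (τ i) (τ-aut i))
    H-inj : ∀ i j → H i ≡ H j → i ≡ j
    H-inj i j Hi≡Hj = e-inj i j (trans (sym (τu≡e i)) (trans τiu≡τju (τu≡e j)))
      where
      τiu≡τju = proj₁ (straight (τ i) (τ j) (τ-aut i) (τ-aut j)
        (≈ₑ-viaIndex ε (proj₂ (edgeIndex (τ i) (τ-aut i))) (proj₂ (edgeIndex (τ j) (τ-aut j))) Hi≡Hj))
    lift : ∀ ρ → IsAut Γ ρ → ∃[ i ] (ρ ⟨$⟩ʳ u ≡ τ i ⟨$⟩ʳ u × ρ ⟨$⟩ʳ v ≡ τ i ⟨$⟩ʳ v)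
    lift ρ ρ-aut =
      let (l , εl≈ρuv) = edgeIndex ρ ρ-aut
          (i , Hi≡l) = injective⇒surjective H H-inj l
      in i , straight ρ (τ i) ρ-aut (τ-aut i)
               (≈ₑ-viaIndex ε εl≈ρuv (proj₂ (edgeIndex (τ i) (τ-aut i))) (sym Hi≡l))
    i = proj₁ (lift σ σ-aut)
    i′ = proj₁ (lift P.id Aut-id)
    i≡i′ : i ≡ i′
    i≡i′ = e-inj i i′ (begin
      e i           ≡⟨ sym (τu≡e i) ⟩
      τ i ⟨$⟩ʳ u    ≡⟨ sym (proj₁ (proj₂ (lift σ σ-aut))) ⟩
      σ ⟨$⟩ʳ u      ≡⟨ σu≡u ⟩
      u             ≡⟨ proj₁ (proj₂ (lift P.id Aut-id)) ⟩
      τ i′ ⟨$⟩ʳ u   ≡⟨ τu≡e i′ ⟩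
      e i′          ∎)

  ≼-moveˡ : ∀ {x y x′} → x ≼ y → InOrbit Γ x x′ → ∃[ y′ ] (InOrbit Γ y y′ × x′ ≼ y′)
  ≼-moveˡ {y = y} x≼y (τ , τ-aut , τx≡x′) =
    τ ⟨$⟩ʳ y , orbit-image τ τ-aut y , subst (λ z → z ≼ τ ⟨$⟩ʳ y) τx≡x′ (≼-image τ τ-aut x≼y)

  ≼-moveʳ : ∀ {x y y′} → x ≼ y → InOrbit Γ y y′ → ∃[ x′ ] (InOrbit Γ x x′ × x′ ≼ y′)
  ≼-moveʳ {x = x} x≼y (τ , τ-aut , τy≡y′) =
    τ ⟨$⟩ʳ x , orbit-image τ τ-aut x , subst (τ ⟨$⟩ʳ x ≼_) τy≡y′ (≼-image τ τ-aut x≼y)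

  adj-fixed-orbit : ∀ {u v v′} → IsFixed Γ u → InOrbit Γ v v′ → adj Γ u v′ ≡ adj Γ u v
  adj-fixed-orbit {u} {v} {v′} u-fixed (ρ , ρ-aut , ρv≡v′) = begin
    adj Γ u v′                    ≡⟨ cong₂ (adj Γ) (sym (u-fixed ρ ρ-aut)) (sym ρv≡v′) ⟩
    adj Γ (ρ ⟨$⟩ʳ u) (ρ ⟨$⟩ʳ v)   ≡⟨ ρ-aut u v ⟩
    adj Γ u v                     ∎
    where open ≡-Reasoning

module UniformTwoTransitive {N n : ℕ} (Γ : Graph N) (3<n : 3 < n) (uniform : Uniform n Γ)
       (two-transitive : ∀ x → ¬ IsFixed Γ x → TwoTransitiveOnOrbit Γ x) where
  open Automorphisms Γ

  orbitCard : ∀ {x} → ¬ IsFixed Γ x → HasCard _≡_ (InOrbit Γ x) n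
  orbitCard = proj₁ uniform _

  ≼-symmetric : ∀ {x y} → ¬ IsFixed Γ x → ¬ IsFixed Γ y → x ≼ y → y ≼ x
  ≼-symmetric x-moved y-moved = equalOrbitSizes-≼-sym (orbitCard x-moved) (orbitCard y-moved)

  ≼-sameOrbit⇒≡ : ∀ {x y} → ¬ IsFixed Γ x → InOrbit Γ x y → x ≼ y → x ≡ y
  ≼-sameOrbit⇒≡ x-moved =
    twoTransitiveOrbit-≼⇒≡ (≤-trans (n≤1+n 3) 3<n) (orbitCard x-moved) (two-transitive _ x-moved)

  adjacent⇒≼ : ∀ {u v} → ¬ IsFixed Γ u → adj Γ u v ≡ true → u ≼ v
  adjacent⇒≼ u-moved uv = edge⇒≼ (orbitCard u-moved) edgeCard uv
    (no-edge-in-orbit 3<n (orbitCard u-moved) (two-transitive _ u-moved) edgeCard uv)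
    where edgeCard = proj₂ uniform _ uv

  -- The automorphism τ carrying u to u′ carries v to v′, since τ v ≼ u′ ≼ v′ within one orbit.
  adj-transport : ∀ {u v u′ v′} → ¬ IsFixed Γ u → ¬ IsFixed Γ v → InOrbit Γ u u′ → InOrbit Γ v v′ →
                  u ≼ v → u′ ≼ v′ → adj Γ u′ v′ ≡ adj Γ u v
  adj-transport {u} {v} {u′} {v′} u-moved v-moved (τ , τ-aut , τu≡u′) v~v′ u≼v u′≼v′ = begin
    adj Γ u′ v′                   ≡⟨ cong₂ (adj Γ) (sym τu≡u′) (sym τv≡v′) ⟩
    adj Γ (τ ⟨$⟩ʳ u) (τ ⟨$⟩ʳ v)   ≡⟨ τ-aut u v ⟩
    adj Γ u v                     ∎
    where
    open ≡-Reasoning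
    τv-moved = nonfixed-orbit v-moved (orbit-image τ τ-aut v)
    u′≼τv : u′ ≼ τ ⟨$⟩ʳ v
    u′≼τv = subst (_≼ τ ⟨$⟩ʳ v) τu≡u′ (≼-image τ τ-aut u≼v)
    τv≡v′ : τ ⟨$⟩ʳ v ≡ v′
    τv≡v′ = ≼-sameOrbit⇒≡ τv-moved (orbit-trans (orbit-sym (orbit-image τ τ-aut v)) v~v′)
      (≼-trans (≼-symmetric (nonfixed-orbit u-moved (τ , τ-aut , τu≡u′)) τv-moved u′≼τv) u′≼v′)

  adj-determined-by-≼ : ∀ {u v u′ v′} → ¬ IsFixed Γ u → ¬ IsFixed Γ v → InOrbit Γ u u′ → InOrbit Γ v v′ →
                        (u ≼ v → u′ ≼ v′) → (u′ ≼ v′ → u ≼ v) → adj Γ u′ v′ ≡ adj Γ u v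
  adj-determined-by-≼ {u} {v} {u′} {v′} u-moved v-moved u~u′ v~v′ to from with adj Γ u v in uv
  ... | true = trans (adj-transport u-moved v-moved u~u′ v~v′ u≼v (to u≼v)) uv
    where u≼v = adjacent⇒≼ u-moved uv
  ... | false with adj Γ u′ v′ in u′v′
  ...   | false = refl
  ...   | true  = trans (sym u′v′) (trans (adj-transport u-moved v-moved u~u′ v~v′ (from u′≼v′) u′≼v′) uv)
    where u′≼v′ = adjacent⇒≼ (nonfixed-orbit u-moved u~u′) u′v′

module OrbitBlocks {N n r m : ℕ} (Γ : Graph N) (3<n : 3 < n) (uniform : Uniform n Γ)
       (two-transitive : ∀ x → ¬ IsFixed Γ x → TwoTransitiveOnOrbit Γ x)
       (orbits : NumNontrivialOrbits Γ r) (fixedPoints : NumFixedPoints Γ m) where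
  open Automorphisms Γ
  open UniformTwoTransitive Γ 3<n uniform two-transitive

  rep : Fin r → Fin N
  rep = proj₁ orbits

  rep-moved : ∀ i → ¬ IsFixed Γ (rep i)
  rep-moved = proj₁ (proj₂ orbits)

  rep-covers : ∀ x → ¬ IsFixed Γ x → ∃[ i ] InOrbit Γ (rep i) x
  rep-covers = proj₂ (proj₂ (proj₂ orbits))

  orbitIndex-unique : ∀ {i j x} → InOrbit Γ (rep i) x → InOrbit Γ (rep j) x → i ≡ j
  orbitIndex-unique i~x j~x = proj₁ (proj₂ (proj₂ orbits)) _ _ (orbit-trans i~x (orbit-sym j~x))

  orbit-moved : ∀ {i x} → InOrbit Γ (rep i) x → ¬ IsFixed Γ x
  orbit-moved = nonfixed-orbit (rep-moved _)

  fixedPoint : Fin m → Fin N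
  fixedPoint = proj₁ fixedPoints

  fixedPoint-fixed : ∀ j → IsFixed Γ (fixedPoint j)
  fixedPoint-fixed = proj₁ (proj₂ fixedPoints)

  fixedPoint-injective : ∀ j j′ → fixedPoint j ≡ fixedPoint j′ → j ≡ j′
  fixedPoint-injective = proj₁ (proj₂ (proj₂ fixedPoints))

  fixedPoint-covers : ∀ x → IsFixed Γ x → ∃[ j ] fixedPoint j ≡ x
  fixedPoint-covers = proj₂ (proj₂ (proj₂ fixedPoints))

  fixed? : ∀ x → Dec (IsFixed Γ x)
  fixed? x with any? (λ j → fixedPoint j ≟ x)
  ... | yes (j , fj≡x) = yes (subst (IsFixed Γ) fj≡x (fixedPoint-fixed j))
  ... | no ¬listed = no (λ x-fixed → ¬listed (fixedPoint-covers x x-fixed))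

  orbitPoint : Fin r → Fin n → Fin N
  orbitPoint i = proj₁ (orbitCard (rep-moved i))

  orbitPoint-orbit : ∀ i p → InOrbit Γ (rep i) (orbitPoint i p)
  orbitPoint-orbit i = proj₁ (proj₂ (orbitCard (rep-moved i)))

  orbitPoint-injective : ∀ i p q → orbitPoint i p ≡ orbitPoint i q → p ≡ q
  orbitPoint-injective i = proj₁ (proj₂ (proj₂ (orbitCard (rep-moved i))))

  orbitPoint-covers : ∀ i x → InOrbit Γ (rep i) x → ∃[ p ] orbitPoint i p ≡ x
  orbitPoint-covers i = proj₂ (proj₂ (proj₂ (orbitCard (rep-moved i))))

  orbitPoint-moved : ∀ i p → ¬ IsFixed Γ (orbitPoint i p)
  orbitPoint-moved i p = orbit-moved (orbitPoint-orbit i p)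

  -- The blocks of the theorem are the classes of orbits whose points have the same stabilisers.
  Linked : Fin r → Fin r → Set
  Linked i j = ∃[ p ] rep i ≼ orbitPoint j p

  linked : ∀ {i j x y} → InOrbit Γ (rep i) x → InOrbit Γ (rep j) y → x ≼ y → Linked i j
  linked {i} {j} i~x j~y x≼y =
    let (y′ , y~y′ , rep≼y′) = ≼-moveˡ x≼y (orbit-sym i~x)
        (p , e≡y′) = orbitPoint-covers j y′ (orbit-trans j~y y~y′)
    in p , subst (rep i ≼_) (sym e≡y′) rep≼y′

  linked-isDecEquivalence : IsDecEquivalence Linked
  linked-isDecEquivalence = record
    { isEquivalence = record { refl = linked-refl ; sym = linked-sym ; trans = linked-trans }
    ; _≟_ = λ i j → any? (λ p → rep i ≼? orbitPoint j p) }
    where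
    linked-refl : ∀ {i} → Linked i i
    linked-refl {i} = linked (orbit-refl (rep i)) (orbit-refl (rep i)) (≼-refl (rep i))
    linked-sym : ∀ {i j} → Linked i j → Linked j i
    linked-sym {i} {j} (p , rep≼e) =
      linked (orbitPoint-orbit j p) (orbit-refl (rep i)) (≼-symmetric (rep-moved i) (orbitPoint-moved j p) rep≼e)
    linked-trans : ∀ {i j l} → Linked i j → Linked j l → Linked i l
    linked-trans {i} {j} {l} (p , repi≼ejp) (q , repj≼elq) =
      let (y , elq~y , ejp≼y) = ≼-moveˡ repj≼elq (orbitPoint-orbit j p)
      in linked (orbit-refl (rep i)) (orbit-trans (orbitPoint-orbit l q) elq~y) (≼-trans repi≼ejp ejp≼y)

  open Partition (partition r linked-isDecEquivalence) public

  base : Fin s → Fin r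
  base b = member b (fromℕ< (rs-positive b))

  block-member : ∀ b c → block (member b c) ≡ b
  block-member b c = cong proj₁ (copy-member b c)

  basePoint : Fin s → Fin n → Fin N
  basePoint b = orbitPoint (base b)

  coordinate : ∀ {i x} → InOrbit Γ (rep i) x → ∃[ p ] basePoint (block i) p ≼ x
  coordinate {i} {x} i~x =
    let (q , base≼eiq) = sameBlock⇒related (base (block i)) i (block-member (block i) _)
        (x′ , base~x′ , x′≼x) = ≼-moveʳ base≼eiq (orbit-trans (orbit-sym (orbitPoint-orbit i q)) i~x)
        (p , e≡x′) = orbitPoint-covers (base (block i)) x′ base~x′
    in p , subst (_≼ x) (sym e≡x′) x′≼x

  pointWithCoordinate : ∀ b c p → ∃[ y ] (InOrbit Γ (rep (member b c)) y × basePoint b p ≼ y)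
  pointWithCoordinate b c p =
    let (q , base≼eq) = sameBlock⇒related (base b) (member b c) (trans (block-member b _) (sym (block-member b c)))
        (y , eq~y , bp≼y) = ≼-moveˡ base≼eq (orbitPoint-orbit (base b) p)
    in y , orbit-trans (orbitPoint-orbit (member b c) q) eq~y , bp≼y

  coordinate-unique : ∀ {b p q x} → ¬ IsFixed Γ x → basePoint b p ≼ x → basePoint b q ≼ x → p ≡ q
  coordinate-unique {b} {p} {q} x-moved bp≼x bq≼x = orbitPoint-injective (base b) p q
    (≼-sameOrbit⇒≡ (orbitPoint-moved (base b) p)
      (orbit-trans (orbit-sym (orbitPoint-orbit (base b) p)) (orbitPoint-orbit (base b) q))
      (≼-trans bp≼x (≼-symmetric (orbitPoint-moved (base b) q) x-moved bq≼x)))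

  ≼-viaBasePoint : ∀ {b p u v} → ¬ IsFixed Γ u → basePoint b p ≼ u → basePoint b p ≼ v → u ≼ v
  ≼-viaBasePoint {b} {p} u-moved bp≼u bp≼v = ≼-trans (≼-symmetric (orbitPoint-moved (base b) p) u-moved bp≼u) bp≼v

  Point : Set
  Point = Points n s rs m

  Describes : Point → Fin N → Set
  Describes (inj₁ (b , c , p)) x = InOrbit Γ (rep (member b c)) x × basePoint b p ≼ x
  Describes (inj₂ j)           x = fixedPoint j ≡ x

  describe : ∀ x → ∃[ z ] Describes z x
  describe x with fixed? x
  ... | yes x-fixed = let (j , fj≡x) = fixedPoint-covers x x-fixed in inj₂ j , fj≡x
  ... | no x-moved =
    let (i , i~x) = rep-covers x x-moved
        (p , bp≼x) = coordinate i~x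
    in inj₁ (block i , copy i , p) , subst (λ i′ → InOrbit Γ (rep i′) x) (sym (member-copy i)) i~x , bp≼x

  realise : ∀ z → ∃[ x ] Describes z x
  realise (inj₁ (b , c , p)) = pointWithCoordinate b c p
  realise (inj₂ j)           = fixedPoint j , refl

  describes-injective : ∀ {z x y} → Describes z x → Describes z y → x ≡ y
  describes-injective {inj₁ _} (i~x , bp≼x) (i~y , bp≼y) =
    ≼-sameOrbit⇒≡ (orbit-moved i~x) (orbit-trans (orbit-sym i~x) i~y) (≼-viaBasePoint (orbit-moved i~x) bp≼x bp≼y)
  describes-injective {inj₂ _} fj≡x fj≡y = trans (sym fj≡x) fj≡y

  describes-functional : ∀ {z z′ x} → Describes z x → Describes z′ x → z ≡ z′
  describes-functional {inj₁ (b , c , p)} {inj₁ (b′ , c′ , p′)} {x} (i~x , bp≼x) (i′~x , b′p′≼x) =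
    sameCopy⇒≡ sameCopy bp≼x b′p′≼x
    where
    sameCopy : _≡_ {A = Σ (Fin s) (Fin ∘ rs)} (b , c) (b′ , c′)
    sameCopy = begin
      (b , c)                                        ≡⟨ sym (copy-member b c) ⟩
      (block (member b c) , copy (member b c))       ≡⟨ cong (λ i → block i , copy i) (orbitIndex-unique i~x i′~x) ⟩
      (block (member b′ c′) , copy (member b′ c′))   ≡⟨ copy-member b′ c′ ⟩
      (b′ , c′)                                      ∎
      where open ≡-Reasoning
    sameCopy⇒≡ : ∀ {b c p b′ c′ p′} → _≡_ {A = Σ (Fin s) (Fin ∘ rs)} (b , c) (b′ , c′) →
                 basePoint b p ≼ x → basePoint b′ p′ ≼ x →
                 _≡_ {A = Point} (inj₁ (b , c , p)) (inj₁ (b′ , c′ , p′))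
    sameCopy⇒≡ {b} {c} refl bp≼x bp′≼x =
      cong (λ q → inj₁ (b , c , q)) (coordinate-unique (orbit-moved i~x) bp≼x bp′≼x)
  describes-functional {inj₁ _} {inj₂ j} (i~x , _) fj≡x =
    ⊥-elim (orbit-moved i~x (subst (IsFixed Γ) fj≡x (fixedPoint-fixed j)))
  describes-functional {inj₂ j} {inj₁ _} fj≡x (i~x , _) =
    ⊥-elim (orbit-moved i~x (subst (IsFixed Γ) fj≡x (fixedPoint-fixed j)))
  describes-functional {inj₂ j} {inj₂ j′} fj≡x fj′≡x =
    cong inj₂ (fixedPoint-injective j j′ (trans fj≡x (sym fj′≡x)))

  toPoint : Fin N → Point
  toPoint x = proj₁ (describe x)

  toPoint-describes : ∀ x → Describes (toPoint x) x
  toPoint-describes x = proj₂ (describe x)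

  labelling : Fin N ↔ Point
  labelling = mk↔ₛ′ toPoint toVertex
    (λ z → describes-functional (toPoint-describes (toVertex z)) (proj₂ (realise z)))
    (λ x → describes-injective (proj₂ (realise (toPoint x))) (toPoint-describes x))
    where
    toVertex : Point → Fin N
    toVertex z = proj₁ (realise z)

  ≼⇒sameCoordinate : ∀ {b c p b′ c′ p′ u v} → Describes (inj₁ (b , c , p)) u → Describes (inj₁ (b′ , c′ , p′)) v →
                     u ≼ v → _≡_ {A = Fin s × Fin n} (b , p) (b′ , p′)
  ≼⇒sameCoordinate {b} {c} {p} {b′} {c′} {p′} {u} {v} (_ , bp≼u) (j~v , b′p′≼v) u≼v =
    sameBlock⇒sameCoordinate b≡b′ (≼-trans bp≼u u≼v) b′p′≼v
    where
    v-moved = orbit-moved j~v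
    bp≼b′p′ : basePoint b p ≼ basePoint b′ p′
    bp≼b′p′ = ≼-trans (≼-trans bp≼u u≼v) (≼-symmetric (orbitPoint-moved (base b′) p′) v-moved b′p′≼v)
    b≡b′ : b ≡ b′
    b≡b′ = trans (sym (block-member b _)) (trans (related⇒sameBlock _ _
             (linked (orbitPoint-orbit (base b) p) (orbitPoint-orbit (base b′) p′) bp≼b′p′)) (block-member b′ _))
    sameBlock⇒sameCoordinate : ∀ {b b′ p p′} → b ≡ b′ → basePoint b p ≼ v → basePoint b′ p′ ≼ v →
                               _≡_ {A = Fin s × Fin n} (b , p) (b′ , p′)
    sameBlock⇒sameCoordinate {b} refl bp≼v bp′≼v = cong (b ,_) (coordinate-unique v-moved bp≼v bp′≼v)

  sameCoordinate⇒≼ : ∀ {b c p b′ c′ p′ u v} → Describes (inj₁ (b , c , p)) u → Describes (inj₁ (b′ , c′ , p′)) v →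
                     _≡_ {A = Fin s × Fin n} (b , p) (b′ , p′) → u ≼ v
  sameCoordinate⇒≼ (i~u , bp≼u) (_ , bp≼v) refl = ≼-viaBasePoint (orbit-moved i~u) bp≼u bp≼v

  induced : ∀ σ → IsAut Γ σ → Fin s → Permutation′ n
  induced σ σ-aut b = permutationOfInjection f f-injective
    where
    image : ∀ p → ∃[ q ] basePoint b q ≡ σ ⟨$⟩ʳ basePoint b p
    image p = orbitPoint-covers (base b) _ (orbit-trans (orbitPoint-orbit (base b) p) (orbit-image σ σ-aut _))
    f : Fin n → Fin n
    f p = proj₁ (image p)
    f-injective : ∀ p q → f p ≡ f q → p ≡ q
    f-injective p q fp≡fq = orbitPoint-injective (base b) p q (Injection.injective (↔⇒↣ σ)
      (trans (sym (proj₂ (image p))) (trans (cong (basePoint b) fp≡fq) (proj₂ (image q)))))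

  induced-basePoint : ∀ σ σ-aut b p → basePoint b (induced σ σ-aut b ⟨$⟩ʳ p) ≡ σ ⟨$⟩ʳ basePoint b p
  induced-basePoint σ σ-aut b p =
    proj₂ (orbitPoint-covers (base b) _ (orbit-trans (orbitPoint-orbit (base b) p) (orbit-image σ σ-aut _)))

  aut-describes : ∀ σ σ-aut {z x} → Describes z x → Describes (act (induced σ σ-aut) z) (σ ⟨$⟩ʳ x)
  aut-describes σ σ-aut {inj₁ (b , c , p)} {x} (i~x , bp≼x) =
    orbit-trans i~x (orbit-image σ σ-aut x) ,
    subst (_≼ σ ⟨$⟩ʳ x) (sym (induced-basePoint σ σ-aut b p)) (≼-image σ σ-aut bp≼x)
  aut-describes σ σ-aut {inj₂ j} fj≡x = trans (sym (fixedPoint-fixed j σ σ-aut)) (cong (σ ⟨$⟩ʳ_) fj≡x)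

  adj-preserved : ∀ (πs : Fin s → Permutation′ n) {z w u v u′ v′} → Describes z u → Describes w v →
                  Describes (act πs z) u′ → Describes (act πs w) v′ → adj Γ u′ v′ ≡ adj Γ u v
  adj-preserved πs {inj₂ j} {inj₂ j′} fj≡u fj′≡v fj≡u′ fj′≡v′ =
    cong₂ (adj Γ) (trans (sym fj≡u′) fj≡u) (trans (sym fj′≡v′) fj′≡v)
  adj-preserved πs {inj₂ j} {inj₁ _} {u} fj≡u (i~v , _) fj≡u′ (i~v′ , _) =
    trans (cong (λ x → adj Γ x _) (trans (sym fj≡u′) fj≡u))
          (adj-fixed-orbit (subst (IsFixed Γ) fj≡u (fixedPoint-fixed j)) (orbit-trans (orbit-sym i~v) i~v′))
  adj-preserved πs {inj₁ z} {inj₂ w} {u} {v} {u′} {v′} du dv du′ dv′ =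
    trans (Graph.sym Γ u′ v′) (trans (adj-preserved πs {inj₂ w} {inj₁ z} dv du dv′ du′) (Graph.sym Γ v u))
  adj-preserved πs {inj₁ (b , c , p)} {inj₁ (b′ , c′ , p′)} du dv du′ dv′ =
    adj-determined-by-≼ (orbit-moved (proj₁ du)) (orbit-moved (proj₁ dv))
      (orbit-trans (orbit-sym (proj₁ du)) (proj₁ du′)) (orbit-trans (orbit-sym (proj₁ dv)) (proj₁ dv′))
      (λ u≼v → sameCoordinate⇒≼ du′ dv′ (cong move (≼⇒sameCoordinate du dv u≼v)))
      (λ u′≼v′ → sameCoordinate⇒≼ du dv (move-injective (≼⇒sameCoordinate du′ dv′ u′≼v′)))
    where
    move : Fin s × Fin n → Fin s × Fin n
    move (b , p) = b , πs b ⟨$⟩ʳ p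
    move-injective : ∀ {b b′ p p′} → move (b , p) ≡ move (b′ , p′) → _≡_ {A = Fin s × Fin n} (b , p) (b′ , p′)
    move-injective {b} eq with refl ← cong proj₁ eq =
      cong (b ,_) (Injection.injective (↔⇒↣ (πs b)) (cong proj₂ eq))

  isAut⇔ : ∀ σ → IsAut Γ σ ⇔
    (∃[ πs ] ∀ x → Inverse.to labelling (σ ⟨$⟩ʳ x) ≡ act {n} {s} {rs} {m} πs (Inverse.to labelling x))
  isAut⇔ σ = mk⇔
    (λ σ-aut → induced σ σ-aut , λ x →
      describes-functional (toPoint-describes (σ ⟨$⟩ʳ x)) (aut-describes σ σ-aut (toPoint-describes x)))
    (λ (πs , commutes) u v →
      adj-preserved πs (toPoint-describes u) (toPoint-describes v)
                       (image-describes πs commutes u) (image-describes πs commutes v))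
    where
    image-describes : ∀ πs → (∀ x → toPoint (σ ⟨$⟩ʳ x) ≡ act πs (toPoint x)) →
                      ∀ x → Describes (act πs (toPoint x)) (σ ⟨$⟩ʳ x)
    image-describes πs commutes x =
      subst (λ z → Describes z (σ ⟨$⟩ʳ x)) (commutes x) (toPoint-describes (σ ⟨$⟩ʳ x))

lemma2p4 : (N n r m : ℕ) (Γ : Graph N) →
    3 < n →
    Uniform n Γ →
    1 ≤ r →
    NumNontrivialOrbits Γ r →
    NumFixedPoints Γ m →
    (∀ x → ¬ IsFixed Γ x → TwoTransitiveOnOrbit Γ x) →
    Σ ℕ λ s → 1 ≤ s × Σ (Fin s → ℕ) λ rs →
      (∀ b → 1 ≤ rs b) × ∑ rs ≡ r × PermIsoToSum Γ n s rs m
lemma2p4 N n r m Γ 3<n uniform 1≤r orbits fixedPoints two-transitive =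
  s , nonempty (block (fromℕ< 1≤r)) , rs , rs-positive , ∑rs≡r , labelling , isAut⇔
  where
  open OrbitBlocks Γ 3<n uniform two-transitive orbits fixedPoints
  nonempty : ∀ {k} → Fin k → 1 ≤ k
  nonempty {suc k} _ = s≤s z≤n
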